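{- (Composition of simultaneous substitutions.) If $\Psi';\Gamma'\vdash\sigma';\delta':\Psi'';\Gamma''$ and $\Psi;\Gamma\vdash\sigma;\delta:\Psi';\Gamma'$, then $\Psi;\Gamma\vdash(\sigma';\delta')\circ(\sigma;\delta):\Psi'';\Gamma''$.
   Context: Types: $T::=\mathsf{Nat}\mid\square T\mid S\to T$. $\mathrm{core}\,T$: $T$ built from $\mathsf{Nat}$ and $\to$ only. $\mathrm{type}\,T$: $\mathsf{Nat}$; $S\to T$ with $S,T$ valid; $\square T$ with $\mathrm{core}\,T$. Local contexts $\Gamma::=\cdot\mid\Gamma,x:T$, global contexts $\Psi::=\cdot\mid\Psi,u:T$; $\mathrm{core},\mathrm{type}$ extend pointwise. Terms $t::=x\mid u\mid\mathsf{zero}\mid\mathsf{succ}\,t\mid\mathsf{box}\,t\mid\mathsf{letbox}\,u=s\,\mathsf{in}\,t\mid\lambda x.t\mid s\ t$. Typing $\Psi;\Gamma\vdash_i t:T$ ($i\in\{0,1\}$), with $C_0$="$\mathrm{core}\,\Psi$, $\mathrm{core}\,\Gamma$", $C_1$="$\mathrm{core}\,\Psi$, $\mathrm{type}\,\Gamma$": under $C_i$, $\vdash_i\mathsf{zero}:\mathsf{Nat}$, $\vdash_i u:T$ for $u:T\in\Psi$, $\vdash_i x:T$ for $x:T\in\Gamma$; succ preserves $\mathsf{Nat}$ at layer $i$; $\Psi;\Gamma,x:S\vdash_i t:T\Rightarrow\Psi;\Gamma\vdash_i\lambda x.t:S\to T$; application at layer $i$; $\mathrm{type}\,\Gamma$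 and $\Psi;\cdot\vdash_0 t:T$ give $\Psi;\Gamma\vdash_1\mathsf{box}\,t:\square T$; $\Psi;\Gamma\vdash_1 s:\square T$ and $\Psi,u:T;\Gamma\vdash_1 t:T'$ give $\Psi;\Gamma\vdash_1\mathsf{letbox}\,u=s\,\mathsf{in}\,t:T'$. Global substitutions $\sigma::=\cdot\mid\sigma,t/u$: $\Psi\vdash\cdot:\cdot$ if $\mathrm{core}\,\Psi$; $\Psi\vdash\sigma,t/u:\Phi,u:T$ if $\Psi\vdash\sigma:\Phi$ and $\Psi;\cdot\vdash_0 t:T$. Local substitutions $\delta::=\cdot\mid\delta,t/x$: $\Psi;\Gamma\vdash\cdot:\cdot$ if $\mathrm{core}\,\Psi$, $\mathrm{type}\,\Gamma$; $\Psi;\Gamma\vdash\delta,t/x:\Delta,x:T$ if $\Psi;\Gamma\vdash\delta:\Delta$ and $\Psi;\Gamma\vdash_1 t:T$. $\Psi;\Gamma\vdash\sigma;\delta:\Phi;\Delta$ iff $\Psi\vdash\sigma:\Phi$ and $\Psi;\Gamma\vdash\delta:\Delta$. Global application: $x[\sigma]=x$, $u[\sigma]=\sigma(u)$, $(\mathsf{box}\,t)[\sigma]=\mathsf{box}(t[\sigma])$, $(\mathsf{letbox}\,u=s\,\mathsf{in}\,t)[\sigma]=\mathsf{letbox}\,u=s[\sigma]\,\mathsf{in}\,(t[\sigma,u/u])$, homomorphic otherwise. Local application: $x[\delta]=\delta(x)$, $u[\delta]=u$, $(\mathsf{box}\,t)[\delta]=\mathsf{box}\,t$, $(\lambda x.t)[\delta]=\lambda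 x.(t[\delta,x/x])$, homomorphic otherwise. $\sigma'\circ\sigma$ applies $\sigma$ to each term of $\sigma'$; $\delta[\sigma]$ applies $\sigma$ to each term of $\delta$; $\delta'\circ\delta$ applies $\delta$ to each term of $\delta'$; $(\sigma';\delta')\circ(\sigma;\delta):=(\sigma'\circ\sigma;\ \delta'[\sigma]\circ\delta)$. -}

module Defs where

-- Layered modal type theory (two layers), de Bruijn representation.
-- Local variables  x  are  lvar n  (index into Γ, 0 = most recent),
-- global variables u  are  gvar n  (index into Ψ, 0 = most recent).

open import Data.Nat using (ℕ; zero; suc; _<ᵇ_)
open import Data.Bool using (if_then_else_)
open import Data.Product using (_×_; _,_) public
open import Data.List using (List; []; _∷_; map)

infixr 30 _⇒_
data Ty : Set where
  Nat : Ty
  □   : Ty → Ty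
  _⇒_ : Ty → Ty → Ty

data core : Ty → Set where
  core-Nat : core Nat
  core-⇒   : ∀ {S T} → core S → core T → core (S ⇒ T)

data type : Ty → Set where
  type-Nat : type Nat
  type-⇒   : ∀ {S T} → type S → type T → type (S ⇒ T)
  type-□   : ∀ {T} → core T → type (□ T)

-- contexts: lists, head = most recently added (Γ , x:T  is  T ∷ Γ)
Ctx : Set
Ctx = List Ty

data coreCtx : Ctx → Set where
  []  : coreCtx []
  _∷_ : ∀ {T Γ} → core T → coreCtx Γ → coreCtx (T ∷ Γ)

data typeCtx : Ctx → Set where
  []  : typeCtx []
  _∷_ : ∀ {T Γ} → type T → typeCtx Γ → typeCtx (T ∷ Γ)

data _∋_∶_ : Ctx → ℕ → Ty → Set where
  here  : ∀ {Γ T} → (T ∷ Γ) ∋ zero ∶ T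
  there : ∀ {Γ S T n} → Γ ∋ n ∶ T → (S ∷ Γ) ∋ suc n ∶ T

data Tm : Set where
  lvar   : ℕ → Tm
  gvar   : ℕ → Tm
  tzero  : Tm
  tsucc  : Tm → Tm
  box    : Tm → Tm
  letbox : Tm → Tm → Tm         -- letbox u = s in t   (t binds a global var)
  lam    : Tm → Tm              -- λ x. t              (t binds a local var)
  app    : Tm → Tm → Tm

data Layer : Set where
  L0 L1 : Layer

-- the Γ-part of the side condition C_i (the Ψ-part is core Ψ for both)
CondΓ : Layer → Ctx → Set
CondΓ L0 Γ = coreCtx Γ
CondΓ L1 Γ = typeCtx Γ

data _︔_⊢[_]_∶_ : Ctx → Ctx → Layer → Tm → Ty → Set where
  t-zero : ∀ {Ψ Γ i} → coreCtx Ψ → CondΓ i Γ → Ψ ︔ Γ ⊢[ i ] tzero ∶ Nat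
  t-gvar : ∀ {Ψ Γ i u T} → coreCtx Ψ → CondΓ i Γ → Ψ ∋ u ∶ T →
           Ψ ︔ Γ ⊢[ i ] gvar u ∶ T
  t-lvar : ∀ {Ψ Γ i x T} → coreCtx Ψ → CondΓ i Γ → Γ ∋ x ∶ T →
           Ψ ︔ Γ ⊢[ i ] lvar x ∶ T
  t-succ : ∀ {Ψ Γ i t} → Ψ ︔ Γ ⊢[ i ] t ∶ Nat → Ψ ︔ Γ ⊢[ i ] tsucc t ∶ Nat
  t-lam  : ∀ {Ψ Γ i t S T} → Ψ ︔ (S ∷ Γ) ⊢[ i ] t ∶ T →
           Ψ ︔ Γ ⊢[ i ] lam t ∶ (S ⇒ T)
  t-app  : ∀ {Ψ Γ i s t S T} → Ψ ︔ Γ ⊢[ i ] s ∶ (S ⇒ T) → Ψ ︔ Γ ⊢[ i ] t ∶ S →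
           Ψ ︔ Γ ⊢[ i ] app s t ∶ T
  t-box  : ∀ {Ψ Γ t T} → typeCtx Γ → Ψ ︔ [] ⊢[ L0 ] t ∶ T →
           Ψ ︔ Γ ⊢[ L1 ] box t ∶ □ T
  t-letbox : ∀ {Ψ Γ s t T T'} → Ψ ︔ Γ ⊢[ L1 ] s ∶ □ T →
           (T ∷ Ψ) ︔ Γ ⊢[ L1 ] t ∶ T' →
           Ψ ︔ Γ ⊢[ L1 ] letbox s t ∶ T'

-- Shifting (needed for the de Bruijn reading of "σ,u/u" and "δ,x/x")

-- increment local variables ≥ c  (box bodies are local-closed and are
-- left untouched, matching (box t)[δ] = box t)
shiftL : ℕ → Tm → Tm
shiftL c (lvar x) = if x <ᵇ c then lvar x else lvar (suc x)
shiftL c (gvar u) = gvar u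
shiftL c tzero = tzero
shiftL c (tsucc t) = tsucc (shiftL c t)
shiftL c (box t) = box t
shiftL c (letbox s t) = letbox (shiftL c s) (shiftL c t)
shiftL c (lam t) = lam (shiftL (suc c) t)
shiftL c (app s t) = app (shiftL c s) (shiftL c t)

shiftG : ℕ → Tm → Tm
shiftG c (lvar x) = lvar x
shiftG c (gvar u) = if u <ᵇ c then gvar u else gvar (suc u)
shiftG c tzero = tzero
shiftG c (tsucc t) = tsucc (shiftG c t)
shiftG c (box t) = box (shiftG c t)
shiftG c (letbox s t) = letbox (shiftG c s) (shiftG (suc c) t)
shiftG c (lam t) = lam (shiftG c t)
shiftG c (app s t) = app (shiftG c s) (shiftG c t)

-- Substitutions: lists of terms, head = substitute for variable 0
-- (σ , t/u  is  t ∷ σ)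

GSubst : Set
GSubst = List Tm

LSubst : Set
LSubst = List Tm

-- σ(u), δ(x); out of range: the variable itself (never happens for
-- well-typed substitutions)
lookupG : GSubst → ℕ → Tm
lookupG []      u       = gvar u
lookupG (t ∷ σ) zero    = t
lookupG (t ∷ σ) (suc u) = lookupG σ u

lookupL : LSubst → ℕ → Tm
lookupL []      x       = lvar x
lookupL (t ∷ δ) zero    = t
lookupL (t ∷ δ) (suc x) = lookupL δ x

_[_]g : Tm → GSubst → Tm
lvar x [ σ ]g = lvar x
gvar u [ σ ]g = lookupG σ u
tzero [ σ ]g = tzero
tsucc t [ σ ]g = tsucc (t [ σ ]g)
box t [ σ ]g = box (t [ σ ]g)
letbox s t [ σ ]g = letbox (s [ σ ]g) (t [ gvar 0 ∷ map (shiftG 0) σ ]g)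
lam t [ σ ]g = lam (t [ σ ]g)
app s t [ σ ]g = app (s [ σ ]g) (t [ σ ]g)

_[_]l : Tm → LSubst → Tm
lvar x [ δ ]l = lookupL δ x
gvar u [ δ ]l = gvar u
tzero [ δ ]l = tzero
tsucc t [ δ ]l = tsucc (t [ δ ]l)
box t [ δ ]l = box t
letbox s t [ δ ]l = letbox (s [ δ ]l) (t [ map (shiftG 0) δ ]l)
lam t [ δ ]l = lam (t [ lvar 0 ∷ map (shiftL 0) δ ]l)
app s t [ δ ]l = app (s [ δ ]l) (t [ δ ]l)

data _⊢g_∶_ : Ctx → GSubst → Ctx → Set where
  g-nil  : ∀ {Ψ} → coreCtx Ψ → Ψ ⊢g [] ∶ []
  g-cons : ∀ {Ψ σ Φ t T} → Ψ ⊢g σ ∶ Φ → Ψ ︔ [] ⊢[ L0 ] t ∶ T →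
           Ψ ⊢g (t ∷ σ) ∶ (T ∷ Φ)

data _︔_⊢l_∶_ : Ctx → Ctx → LSubst → Ctx → Set where
  l-nil  : ∀ {Ψ Γ} → coreCtx Ψ → typeCtx Γ → Ψ ︔ Γ ⊢l [] ∶ []
  l-cons : ∀ {Ψ Γ δ Δ t T} → Ψ ︔ Γ ⊢l δ ∶ Δ → Ψ ︔ Γ ⊢[ L1 ] t ∶ T →
           Ψ ︔ Γ ⊢l (t ∷ δ) ∶ (T ∷ Δ)

_︔_⊢_︔_∶_︔_ : Ctx → Ctx → GSubst → LSubst → Ctx → Ctx → Set
Ψ ︔ Γ ⊢ σ ︔ δ ∶ Φ ︔ Δ = (Ψ ⊢g σ ∶ Φ) × (Ψ ︔ Γ ⊢l δ ∶ Δ)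

_∘g_ : GSubst → GSubst → GSubst
σ' ∘g σ = map (_[ σ ]g) σ'

_[_]ls : LSubst → GSubst → LSubst
δ [ σ ]ls = map (_[ σ ]g) δ

_∘l_ : LSubst → LSubst → LSubst
δ' ∘l δ = map (_[ δ ]l) δ'


_∘gl_ : GSubst × LSubst → GSubst × LSubst → GSubst × LSubst
(σ' , δ') ∘gl (σ , δ) = (σ' ∘g σ , (δ' [ σ ]ls) ∘l δ)

-- Composition reduces to two substitution lemmas, one for each kind of
-- variable, both proved by induction on typing derivations. A global
-- variable is replaced by a closed layer-0 term of core type; such a term is
-- also well typed at layer 1 in any valid local context, because core types
-- are types. Going under the binders of letbox (global) and λ (local) needs
-- the substitution to be shifted, which is the corresponding weakening lemma.
module Submission where

open import Defs
open import Data.Product using (_,_; proj₁; proj₂)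
open import Data.Nat using (ℕ; zero; suc; _<ᵇ_)
open import Data.Bool using (if_then_else_)
open import Data.Bool.Properties using (if-float)
open import Data.List using ([]; _∷_; map; _++_)
open import Relation.Binary.PropositionalEquality using (_≡_; sym; subst)

core⇒type : ∀ {T} → core T → type T
core⇒type core-Nat     = type-Nat
core⇒type (core-⇒ S T) = type-⇒ (core⇒type S) (core⇒type T)

coreCtx-head : ∀ {T Ψ} → coreCtx (T ∷ Ψ) → core T
coreCtx-head (T ∷ _) = T

typeCtx-head : ∀ {T Γ} → typeCtx (T ∷ Γ) → type T
typeCtx-head (T ∷ _) = T

CondΓ-tail : ∀ i {S Γ} → CondΓ i (S ∷ Γ) → CondΓ i Γ
CondΓ-tail L0 (_ ∷ Γ) = Γ
CondΓ-tail L1 (_ ∷ Γ) = Γ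

CondΓ-∷core : ∀ i {S Γ} → core S → CondΓ i Γ → CondΓ i (S ∷ Γ)
CondΓ-∷core L0 S Γ = S ∷ Γ
CondΓ-∷core L1 S Γ = core⇒type S ∷ Γ

⊢-coreCtx : ∀ {Ψ Γ i t T} → Ψ ︔ Γ ⊢[ i ] t ∶ T → coreCtx Ψ
⊢-coreCtx (t-zero Ψ _)   = Ψ
⊢-coreCtx (t-gvar Ψ _ _) = Ψ
⊢-coreCtx (t-lvar Ψ _ _) = Ψ
⊢-coreCtx (t-succ t)     = ⊢-coreCtx t
⊢-coreCtx (t-lam t)      = ⊢-coreCtx t
⊢-coreCtx (t-app s _)    = ⊢-coreCtx s
⊢-coreCtx (t-box _ t)    = ⊢-coreCtx t
⊢-coreCtx (t-letbox s _) = ⊢-coreCtx s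

⊢-CondΓ : ∀ {Ψ Γ i t T} → Ψ ︔ Γ ⊢[ i ] t ∶ T → CondΓ i Γ
⊢-CondΓ (t-zero _ Γ)   = Γ
⊢-CondΓ (t-gvar _ Γ _) = Γ
⊢-CondΓ (t-lvar _ Γ _) = Γ
⊢-CondΓ (t-succ t)     = ⊢-CondΓ t
⊢-CondΓ {i = i} (t-lam t) = CondΓ-tail i (⊢-CondΓ t)
⊢-CondΓ (t-app s _)    = ⊢-CondΓ s
⊢-CondΓ (t-box Γ _)    = Γ
⊢-CondΓ (t-letbox s _) = ⊢-CondΓ s

⊢g-coreCtx : ∀ {Ψ σ Φ} → Ψ ⊢g σ ∶ Φ → coreCtx Ψ
⊢g-coreCtx (g-nil Ψ)    = Ψ
⊢g-coreCtx (g-cons σ _) = ⊢g-coreCtx σ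

⊢l-coreCtx : ∀ {Ψ Γ δ Δ} → Ψ ︔ Γ ⊢l δ ∶ Δ → coreCtx Ψ
⊢l-coreCtx (l-nil Ψ _)  = Ψ
⊢l-coreCtx (l-cons δ _) = ⊢l-coreCtx δ

⊢l-typeCtx : ∀ {Ψ Γ δ Δ} → Ψ ︔ Γ ⊢l δ ∶ Δ → typeCtx Γ
⊢l-typeCtx (l-nil _ Γ)  = Γ
⊢l-typeCtx (l-cons δ _) = ⊢l-typeCtx δ

data Insert : ℕ → Ty → Ctx → Ctx → Set where
  insert-here  : ∀ {S Γ} → Insert zero S Γ (S ∷ Γ)
  insert-there : ∀ {c S T Γ Γ'} → Insert c S Γ Γ' → Insert (suc c) S (T ∷ Γ) (T ∷ Γ')

shiftVar : ℕ → ℕ → ℕ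
shiftVar c n = if n <ᵇ c then n else suc n

shiftVar-suc : ∀ c n → shiftVar (suc c) (suc n) ≡ suc (shiftVar c n)
shiftVar-suc c n = sym (if-float suc (n <ᵇ c))

shiftG-gvar : ∀ c u → shiftG c (gvar u) ≡ gvar (shiftVar c u)
shiftG-gvar c u = sym (if-float gvar (u <ᵇ c))

shiftL-lvar : ∀ c x → shiftL c (lvar x) ≡ lvar (shiftVar c x)
shiftL-lvar c x = sym (if-float lvar (x <ᵇ c))

∋-insert : ∀ {c S Γ Γ' n T} → Insert c S Γ Γ' → Γ ∋ n ∶ T → Γ' ∋ shiftVar c n ∶ T
∋-insert insert-here x                = there x
∋-insert (insert-there ins) here      = here
∋-insert {c = suc c} {n = suc n} (insert-there ins) (there x) =
  subst (_ ∋_∶ _) (sym (shiftVar-suc c n)) (there (∋-insert ins x))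

coreCtx-insert : ∀ {c S Γ Γ'} → core S → Insert c S Γ Γ' → coreCtx Γ → coreCtx Γ'
coreCtx-insert S insert-here        Γ       = S ∷ Γ
coreCtx-insert S (insert-there ins) (T ∷ Γ) = T ∷ coreCtx-insert S ins Γ

typeCtx-insert : ∀ {c S Γ Γ'} → type S → Insert c S Γ Γ' → typeCtx Γ → typeCtx Γ'
typeCtx-insert S insert-here        Γ       = S ∷ Γ
typeCtx-insert S (insert-there ins) (T ∷ Γ) = T ∷ typeCtx-insert S ins Γ

⊢-shiftG : ∀ {c S Ψ Ψ' Γ i t T} → core S → Insert c S Ψ Ψ' →
           Ψ ︔ Γ ⊢[ i ] t ∶ T → Ψ' ︔ Γ ⊢[ i ] shiftG c t ∶ T
⊢-shiftG S ins (t-zero Ψ Γ) = t-zero (coreCtx-insert S ins Ψ) Γ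
⊢-shiftG {c = c} S ins (t-gvar {u = u} Ψ Γ x) =
  subst (_ ︔ _ ⊢[ _ ]_∶ _) (sym (shiftG-gvar c u))
    (t-gvar (coreCtx-insert S ins Ψ) Γ (∋-insert ins x))
⊢-shiftG S ins (t-lvar Ψ Γ x)   = t-lvar (coreCtx-insert S ins Ψ) Γ x
⊢-shiftG S ins (t-succ t)       = t-succ (⊢-shiftG S ins t)
⊢-shiftG S ins (t-lam t)        = t-lam (⊢-shiftG S ins t)
⊢-shiftG S ins (t-app s t)      = t-app (⊢-shiftG S ins s) (⊢-shiftG S ins t)
⊢-shiftG S ins (t-box Γ t)      = t-box Γ (⊢-shiftG S ins t)
⊢-shiftG S ins (t-letbox s t)   =
  t-letbox (⊢-shiftG S ins s) (⊢-shiftG S (insert-there ins) t)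

⊢-shiftL : ∀ {c S Ψ Γ Γ' t T} → type S → Insert c S Γ Γ' →
           Ψ ︔ Γ ⊢[ L1 ] t ∶ T → Ψ ︔ Γ' ⊢[ L1 ] shiftL c t ∶ T
⊢-shiftL S ins (t-zero Ψ Γ)   = t-zero Ψ (typeCtx-insert S ins Γ)
⊢-shiftL S ins (t-gvar Ψ Γ u) = t-gvar Ψ (typeCtx-insert S ins Γ) u
⊢-shiftL {c = c} S ins (t-lvar {x = x} Ψ Γ x∈) =
  subst (_ ︔ _ ⊢[ _ ]_∶ _) (sym (shiftL-lvar c x))
    (t-lvar Ψ (typeCtx-insert S ins Γ) (∋-insert ins x∈))
⊢-shiftL S ins (t-succ t)     = t-succ (⊢-shiftL S ins t)
⊢-shiftL S ins (t-lam t)      = t-lam (⊢-shiftL S (insert-there ins) t)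
⊢-shiftL S ins (t-app s t)    = t-app (⊢-shiftL S ins s) (⊢-shiftL S ins t)
⊢-shiftL S ins (t-box Γ t)    = t-box (typeCtx-insert S ins Γ) t
⊢-shiftL S ins (t-letbox s t) = t-letbox (⊢-shiftL S ins s) (⊢-shiftL S ins t)

∋-++ : ∀ {Δ Γ x T} → Δ ∋ x ∶ T → (Δ ++ Γ) ∋ x ∶ T
∋-++ here      = here
∋-++ (there x) = there (∋-++ x)

⊢₀-embed : ∀ {Ψ Δ Γ i t T} → CondΓ i (Δ ++ Γ) →
           Ψ ︔ Δ ⊢[ L0 ] t ∶ T → Ψ ︔ (Δ ++ Γ) ⊢[ i ] t ∶ T
⊢₀-embed Γ (t-zero Ψ _)   = t-zero Ψ Γ
⊢₀-embed Γ (t-gvar Ψ _ u) = t-gvar Ψ Γ u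
⊢₀-embed Γ (t-lvar Ψ _ x) = t-lvar Ψ Γ (∋-++ x)
⊢₀-embed Γ (t-succ t)     = t-succ (⊢₀-embed Γ t)
⊢₀-embed {i = i} Γ (t-lam t) =
  t-lam (⊢₀-embed (CondΓ-∷core i (coreCtx-head (⊢-CondΓ t)) Γ) t)
⊢₀-embed Γ (t-app s t)    = t-app (⊢₀-embed Γ s) (⊢₀-embed Γ t)

⊢g-lookup : ∀ {Ψ σ Φ u T} → Ψ ⊢g σ ∶ Φ → Φ ∋ u ∶ T → Ψ ︔ [] ⊢[ L0 ] lookupG σ u ∶ T
⊢g-lookup (g-cons σ t) here      = t
⊢g-lookup (g-cons σ t) (there u) = ⊢g-lookup σ u

⊢g-shiftG : ∀ {Ψ σ Φ S} → core S → Ψ ⊢g σ ∶ Φ → (S ∷ Ψ) ⊢g map (shiftG 0) σ ∶ Φ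
⊢g-shiftG S (g-nil Ψ)    = g-nil (S ∷ Ψ)
⊢g-shiftG S (g-cons σ t) = g-cons (⊢g-shiftG S σ) (⊢-shiftG S insert-here t)

⊢g-lift : ∀ {Ψ σ Φ S} → core S → Ψ ⊢g σ ∶ Φ → (S ∷ Ψ) ⊢g (gvar 0 ∷ map (shiftG 0) σ) ∶ (S ∷ Φ)
⊢g-lift S σ = g-cons (⊢g-shiftG S σ) (t-gvar (S ∷ ⊢g-coreCtx σ) [] here)

⊢-[]g : ∀ {Ψ σ Φ Γ i t T} → Ψ ⊢g σ ∶ Φ → Φ ︔ Γ ⊢[ i ] t ∶ T → Ψ ︔ Γ ⊢[ i ] t [ σ ]g ∶ T
⊢-[]g σ (t-zero _ Γ)   = t-zero (⊢g-coreCtx σ) Γ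
⊢-[]g σ (t-gvar _ Γ u) = ⊢₀-embed Γ (⊢g-lookup σ u)
⊢-[]g σ (t-lvar _ Γ x) = t-lvar (⊢g-coreCtx σ) Γ x
⊢-[]g σ (t-succ t)     = t-succ (⊢-[]g σ t)
⊢-[]g σ (t-lam t)      = t-lam (⊢-[]g σ t)
⊢-[]g σ (t-app s t)    = t-app (⊢-[]g σ s) (⊢-[]g σ t)
⊢-[]g σ (t-box Γ t)    = t-box Γ (⊢-[]g σ t)
⊢-[]g σ (t-letbox s t) =
  t-letbox (⊢-[]g σ s) (⊢-[]g (⊢g-lift (coreCtx-head (⊢-coreCtx t)) σ) t)

⊢l-lookup : ∀ {Ψ Γ δ Δ x T} → Ψ ︔ Γ ⊢l δ ∶ Δ → Δ ∋ x ∶ T → Ψ ︔ Γ ⊢[ L1 ] lookupL δ x ∶ T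
⊢l-lookup (l-cons δ t) here      = t
⊢l-lookup (l-cons δ t) (there x) = ⊢l-lookup δ x

⊢l-shiftG : ∀ {Ψ Γ δ Δ S} → core S → Ψ ︔ Γ ⊢l δ ∶ Δ → (S ∷ Ψ) ︔ Γ ⊢l map (shiftG 0) δ ∶ Δ
⊢l-shiftG S (l-nil Ψ Γ)  = l-nil (S ∷ Ψ) Γ
⊢l-shiftG S (l-cons δ t) = l-cons (⊢l-shiftG S δ) (⊢-shiftG S insert-here t)

⊢l-shiftL : ∀ {Ψ Γ δ Δ S} → type S → Ψ ︔ Γ ⊢l δ ∶ Δ → Ψ ︔ (S ∷ Γ) ⊢l map (shiftL 0) δ ∶ Δ
⊢l-shiftL S (l-nil Ψ Γ)  = l-nil Ψ (S ∷ Γ)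
⊢l-shiftL S (l-cons δ t) = l-cons (⊢l-shiftL S δ) (⊢-shiftL S insert-here t)

⊢l-lift : ∀ {Ψ Γ δ Δ S} → type S → Ψ ︔ Γ ⊢l δ ∶ Δ →
          Ψ ︔ (S ∷ Γ) ⊢l (lvar 0 ∷ map (shiftL 0) δ) ∶ (S ∷ Δ)
⊢l-lift S δ = l-cons (⊢l-shiftL S δ) (t-lvar (⊢l-coreCtx δ) (S ∷ ⊢l-typeCtx δ) here)

⊢-[]l : ∀ {Ψ Γ δ Δ t T} → Ψ ︔ Γ ⊢l δ ∶ Δ → Ψ ︔ Δ ⊢[ L1 ] t ∶ T → Ψ ︔ Γ ⊢[ L1 ] t [ δ ]l ∶ T
⊢-[]l δ (t-zero Ψ _)   = t-zero Ψ (⊢l-typeCtx δ)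
⊢-[]l δ (t-gvar Ψ _ u) = t-gvar Ψ (⊢l-typeCtx δ) u
⊢-[]l δ (t-lvar _ _ x) = ⊢l-lookup δ x
⊢-[]l δ (t-succ t)     = t-succ (⊢-[]l δ t)
⊢-[]l δ (t-lam t)      = t-lam (⊢-[]l (⊢l-lift (typeCtx-head (⊢-CondΓ t)) δ) t)
⊢-[]l δ (t-app s t)    = t-app (⊢-[]l δ s) (⊢-[]l δ t)
⊢-[]l δ (t-box _ t)    = t-box (⊢l-typeCtx δ) t
⊢-[]l δ (t-letbox s t) = t-letbox (⊢-[]l δ s) (⊢-[]l (⊢l-shiftG (coreCtx-head (⊢-coreCtx t)) δ) t)

⊢g-∘g : ∀ {Ψ Ψ' Ψ'' σ σ'} → Ψ' ⊢g σ' ∶ Ψ'' → Ψ ⊢g σ ∶ Ψ' → Ψ ⊢g (σ' ∘g σ) ∶ Ψ''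
⊢g-∘g (g-nil _)     σ = g-nil (⊢g-coreCtx σ)
⊢g-∘g (g-cons σ' t) σ = g-cons (⊢g-∘g σ' σ) (⊢-[]g σ t)

⊢l-[]ls : ∀ {Ψ Ψ' Γ Δ σ δ} → Ψ' ︔ Γ ⊢l δ ∶ Δ → Ψ ⊢g σ ∶ Ψ' → Ψ ︔ Γ ⊢l (δ [ σ ]ls) ∶ Δ
⊢l-[]ls (l-nil _ Γ)  σ = l-nil (⊢g-coreCtx σ) Γ
⊢l-[]ls (l-cons δ t) σ = l-cons (⊢l-[]ls δ σ) (⊢-[]g σ t)

⊢l-∘l : ∀ {Ψ Γ Γ' Γ'' δ δ'} → Ψ ︔ Γ' ⊢l δ' ∶ Γ'' → Ψ ︔ Γ ⊢l δ ∶ Γ' → Ψ ︔ Γ ⊢l (δ' ∘l δ) ∶ Γ''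
⊢l-∘l (l-nil Ψ _)   δ = l-nil Ψ (⊢l-typeCtx δ)
⊢l-∘l (l-cons δ' t) δ = l-cons (⊢l-∘l δ' δ) (⊢-[]l δ t)

mainTheorem10 : ∀ {Ψ Γ Ψ' Γ' Ψ'' Γ'' σ δ σ' δ'} →
    Ψ' ︔ Γ' ⊢ σ' ︔ δ' ∶ Ψ'' ︔ Γ'' →
    Ψ ︔ Γ ⊢ σ ︔ δ ∶ Ψ' ︔ Γ' →
    Ψ ︔ Γ ⊢ proj₁ ((σ' , δ') ∘gl (σ , δ)) ︔ proj₂ ((σ' , δ') ∘gl (σ , δ)) ∶ Ψ'' ︔ Γ''
mainTheorem10 (σ' , δ') (σ , δ) = ⊢g-∘g σ' σ , ⊢l-∘l (⊢l-[]ls δ' σ) δ
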